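{- If $B$ is a regular board in the triangular grid, then $x(B) = f(B)$.
   Context: The triangular grid is the tiling of the plane by congruent equilateral triangles (cells); two cells are neighbors if they share an edge. A board is a finite set $B$ of cells such that every cell of $B$ has at least one neighbor in $B$. A board $B$ is regular if for any two non-adjacent cells of $B$ having a common neighbor in the grid, that common neighbor belongs to $B$ (equivalently, $B$ has no exterior angles of 60 degrees). A fragment is a cell $c$ together with a nonempty subset of its neighbors; a maximal fragment is a cell together with all three of its neighbors. $x(B)$ is the minimal number of maximal fragments (placed in the grid) whose union contains $B$; they may overlap each other and may contain cells outside $B$. $f(B)$ is the minimum number of fragments in a partition of $B$ into fragments each contained in $B$. -}

module Defs where

open import Data.Nat using (ℕ; _≤_)
open import Data.Integer using (ℤ; _+_; _-_; 1ℤ)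
open import Data.Fin using (Fin)
open import Data.List using (List; []; _∷_; length; lookup)
open import Data.List.Membership.Propositional using (_∈_)
open import Data.Product using (_×_; Σ; ∃; ∃-syntax; _,_)
open import Data.Sum using (_⊎_)
open import Data.Empty using (⊥)
open import Relation.Nullary using (¬_)
open import Relation.Binary.PropositionalEquality using (_≡_)

-- Coordinates: an "up" triangle U(x,y) and a
-- "down" triangle D(x,y) for every (x,y) ∈ ℤ².
-- U(x,y) is adjacent to D(x,y), D(x-1,y), D(x,y-1);
-- D(x,y) is adjacent to U(x,y), U(x+1,y), U(x,y+1).
-- (The adjacency graph is the hexagonal lattice: bipartite, 3-regular.)
data Ori : Set where
  up down : Ori

record Cell : Set where
  constructor cell
  field
    cx : ℤ
    cy : ℤ
    co : Ori

Adj : Cell → Cell → Set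
Adj (cell x y up) (cell x' y' down) =
  (x' ≡ x × y' ≡ y) ⊎ (x' ≡ x - 1ℤ × y' ≡ y) ⊎ (x' ≡ x × y' ≡ y - 1ℤ)
Adj (cell x y down) (cell x' y' up) =
  (x' ≡ x × y' ≡ y) ⊎ (x' ≡ x + 1ℤ × y' ≡ y) ⊎ (x' ≡ x × y' ≡ y + 1ℤ)
Adj (cell _ _ up) (cell _ _ up) = ⊥
Adj (cell _ _ down) (cell _ _ down) = ⊥

CellSet : Set
CellSet = List Cell

IsBoard : CellSet → Set
IsBoard B = ∀ {c} → c ∈ B → ∃[ d ] (d ∈ B × Adj c d)

IsRegular : CellSet → Set
IsRegular B = ∀ {c₁ c₂ d} → c₁ ∈ B → c₂ ∈ B → ¬ (c₁ ≡ c₂) → ¬ Adj c₁ c₂ →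
              Adj c₁ d → Adj c₂ d → d ∈ B

InMaxFragment : Cell → Cell → Set
InMaxFragment c e = e ≡ c ⊎ Adj c e

-- A family of maximal fragments (given by their centres) whose union contains B.
CoversB : CellSet → List Cell → Set
CoversB B cs = ∀ {e} → e ∈ B → ∃[ c ] (c ∈ cs × InMaxFragment c e)

HasCover : CellSet → ℕ → Set
HasCover B k = Σ (List Cell) λ cs → length cs ≡ k × CoversB B cs

-- A fragment: a centre cell together with a nonempty set of its neighbours
-- (given as a list `n ∷ ns` of neighbours).
record Fragment : Set where
  constructor frag
  field
    centre : Cell
    nb     : Cell
    nbs    : List Cell
    nbAdj  : ∀ {e} → e ∈ (nb ∷ nbs) → Adj centre e

open Fragment public

InFragment : Fragment → Cell → Set
InFragment F e = e ∈ (centre F ∷ nb F ∷ nbs F)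

IsPartition : CellSet → List Fragment → Set
IsPartition B Fs =
  (∀ (i : Fin (length Fs)) {e} → InFragment (lookup Fs i) e → e ∈ B) ×
  (∀ {e} → e ∈ B → ∃[ i ] InFragment (lookup Fs i) e) ×
  (∀ (i j : Fin (length Fs)) {e} → InFragment (lookup Fs i) e →
     InFragment (lookup Fs j) e → i ≡ j)

HasPartition : CellSet → ℕ → Set
HasPartition B k = Σ (List Fragment) λ Fs → length Fs ≡ k × IsPartition B Fs

IsMinimum : (ℕ → Set) → ℕ → Set
IsMinimum P n = P n × (∀ m → P m → n ≤ m)

-- A family of maximal fragments is a set of centres whose closed neighbourhoods cover B,
-- i.e. a dominating set for B in the grid graph.  On a regular board every centre can be moved
-- into B without losing coverage: if c ∉ B, two distinct cells of B adjacent to c would be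
-- non-adjacent (the grid graph is bipartite), so regularity would force c ∈ B; hence c meets B
-- in a single neighbour, which can replace it.  So x(B) is the least size of a dominating set
-- D ⊆ B.  The centres of a partition into fragments form such a cover, so x(B) ≤ f(B).
-- Conversely, in any graph without isolated vertices a dominating set D of B yields a partition
-- of B into at most |D| stars: peel one star off per dominator, keeping the remainder free of
-- isolated vertices and dominated by the remaining dominators.

module Submission where

open import Defs
open import Data.Nat using (ℕ; zero; suc; _≤_; _<_; z≤n; s≤s)
open import Data.Nat.Properties using (≤-refl; ≤-trans; n≤1+n; m≤n⇒m≤1+n; ≤-antisym; ≮⇒≥; anyUpTo?; suc-injective)
open import Data.Nat.Induction using (<-rec)
open import Data.Product using (_×_; ∃-syntax; _,_; proj₁; proj₂)
open import Data.Sum using (_⊎_; inj₁; inj₂; swap)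
open import Data.Empty using (⊥; ⊥-elim)
open import Data.Integer as ℤ using (1ℤ)
open import Data.Integer.Properties using (+-0-abelianGroup)
open import Algebra.Properties.AbelianGroup +-0-abelianGroup using (//-rightDividesˡ; //-rightDividesʳ)
open import Data.Fin using (Fin; zero; suc)
open import Data.List using (List; []; _∷_; length; lookup; map; filter)
open import Data.List.Properties using (length-map; length-filter)
open import Data.List.Membership.Propositional using (_∈_; find; lose)
open import Data.List.Membership.Propositional.Properties using (∈-filter⁺; ∈-filter⁻; ∈-lookup; ∈-map⁺)
open import Data.List.Relation.Binary.Subset.Propositional using (_⊆_)
open import Data.List.Relation.Binary.Subset.Propositional.Properties using (∈-∷⁺ʳ; filter-⊆)
open import Data.List.Relation.Unary.Any as Any using (Any; here; there; any?)
import Data.List.Relation.Unary.Any.Properties as Anyₚ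
open import Data.List.Relation.Unary.All as All using (All; []; _∷_)
open import Data.List.Relation.Unary.AllPairs using (AllPairs; []; _∷_)
import Data.List.Relation.Unary.AllPairs.Properties as AllPairsₚ
import Data.List.Relation.Unary.All.Properties as Allₚ
open import Relation.Nullary using (¬_; Dec; yes; no)
open import Relation.Nullary.Decidable using (_×-dec_; _⊎-dec_; ¬?; decidable-stable)
open import Relation.Binary.Definitions using (DecidableEquality)
open import Function using (_∘_)
open import Relation.Binary.PropositionalEquality using (_≡_; _≢_; refl; sym; trans; cong; subst)

least : {P : ℕ → Set} → (∀ n → Dec (P n)) → ∀ {N} → P N → ∃[ n ] IsMinimum P n
least {P} P? {N} = <-rec (λ N → P N → ∃[ n ] IsMinimum P n) step N
  where
  step : ∀ N → (∀ {m} → m < N → P m → ∃[ n ] IsMinimum P n) → P N → ∃[ n ] IsMinimum P n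
  step N rec pN with anyUpTo? P? N
  ... | yes (m , m<N , pm) = rec m<N pm
  ... | no none = N , pN , λ m pm → ≮⇒≥ (λ m<N → none (m , m<N , pm))

∃-listOver? : {A : Set} (B : List A) {P : List A → Set} → (∀ D → Dec (P D)) →
              ∀ k → Dec (∃[ D ] (length D ≡ k × D ⊆ B × P D))
∃-listOver? B P? zero with P? []
... | yes p = yes ([] , refl , (λ ()) , p)
... | no ¬p = no λ { ([] , _ , _ , p) → ¬p p }
∃-listOver? B P? (suc k) with any? (λ b → ∃-listOver? B (λ D → P? (b ∷ D)) k) B
... | yes ∃b with find ∃b
...   | b , b∈B , D , |D|≡k , D⊆B , p = yes (b ∷ D , cong suc |D|≡k , ∈-∷⁺ʳ b∈B D⊆B , p)
∃-listOver? B P? (suc k) | no ¬∃b =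
  no λ { (b ∷ D , |b∷D|≡1+k , b∷D⊆B , p) →
         ¬∃b (lose (b∷D⊆B (here refl)) (D , suc-injective |b∷D|≡1+k , b∷D⊆B ∘ there , p)) }

module StarPartitions
  {V : Set} (_≟_ : DecidableEquality V)
  (_~_ : V → V → Set) (_~?_ : ∀ u v → Dec (u ~ v)) (~-sym : ∀ u v → u ~ v → v ~ u)
  where

  open import Data.List.Membership.DecPropositional _≟_ using (_∈?_)

  N[_]∋_ : V → V → Set
  N[ u ]∋ v = v ≡ u ⊎ u ~ v

  N[_]∋?_ : ∀ u v → Dec (N[ u ]∋ v)
  N[ u ]∋? v = (v ≟ u) ⊎-dec (u ~? v)

  Dominated : List V → V → Set
  Dominated D v = Any (λ d → N[ d ]∋ v) D

  dominated? : ∀ D v → Dec (Dominated D v)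
  dominated? D v = any? (λ d → N[ d ]∋? v) D

  Dominates : List V → List V → Set
  Dominates D B = ∀ {v} → v ∈ B → Dominated D v

  NoIsolated : List V → Set
  NoIsolated B = ∀ {v} → v ∈ B → ∃[ w ] (w ∈ B × v ~ w)

  record Star : Set where
    constructor star
    field
      hub        : V
      leaf       : V
      leaves     : List V
      hub~leaves : ∀ {v} → v ∈ leaf ∷ leaves → hub ~ v

    members : List V
    members = hub ∷ leaf ∷ leaves

  open Star public

  Disjoint : Star → Star → Set
  Disjoint S T = ∀ {v} → v ∈ members S → v ∈ members T → ⊥

  record StarPartition (B : List V) (k : ℕ) : Set where
    field
      stars    : List Star
      size≤    : length stars ≤ k
      within   : All (λ S → members S ⊆ B) stars
      covering : ∀ {v} → v ∈ B → Any (λ S → v ∈ members S) stars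
      disjoint : AllPairs Disjoint stars

  weaken : ∀ {B k k′} → k ≤ k′ → StarPartition B k → StarPartition B k′
  weaken k≤k′ P = record
    { stars = stars ; size≤ = ≤-trans size≤ k≤k′ ; within = within ; covering = covering ; disjoint = disjoint }
    where open StarPartition P

  module Peel (D B : List V) (x q : V) (x∈B : x ∈ B) (q∈B : q ∈ B) (x~q : x ~ q)
              (q-undominated : ¬ Dominated D q)
              (B⊆N[D]∪N[x] : ∀ {v} → v ∈ B → Dominated D v ⊎ N[ x ]∋ v)
              (D⊆B : D ⊆ B) (noIsolated : NoIsolated B)
              where

    HasOtherNeighbour : V → Set
    HasOtherNeighbour v = Any (λ w → v ~ w × w ≢ x) B

    hasOtherNeighbour? : ∀ v → Dec (HasOtherNeighbour v)
    hasOtherNeighbour? v = any? (λ w → (v ~? w) ×-dec ¬? (w ≟ x)) B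

    -- A neighbour of x joins the star exactly when leaving it behind could break the invariant
    -- for the remainder: it is not dominated by D, or it would become isolated there.
    Leaf : V → Set
    Leaf v = x ~ v × (¬ Dominated D v ⊎ ¬ HasOtherNeighbour v)

    leaf? : ∀ v → Dec (Leaf v)
    leaf? v = (x ~? v) ×-dec (¬? (dominated? D v) ⊎-dec ¬? (hasOtherNeighbour? v))

    Taken : V → Set
    Taken v = v ≡ x ⊎ Leaf v

    untaken? : ∀ v → Dec (¬ Taken v)
    untaken? v = ¬? ((v ≟ x) ⊎-dec leaf? v)

    x~leaf : ∀ {v} → v ∈ q ∷ filter leaf? B → x ~ v
    x~leaf (here refl) = x~q
    x~leaf (there v∈) = proj₁ (proj₂ (∈-filter⁻ leaf? {xs = B} v∈))

    S : Star
    S = star x q (filter leaf? B) x~leaf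

    rest : List V
    rest = filter untaken? B

    D′ : List V
    D′ = filter (_∈? rest) D

    S⊆B : members S ⊆ B
    S⊆B (here refl) = x∈B
    S⊆B (there (here refl)) = q∈B
    S⊆B (there (there v∈)) = proj₁ (∈-filter⁻ leaf? {xs = B} v∈)

    S⊆taken : ∀ {v} → v ∈ members S → Taken v
    S⊆taken (here refl) = inj₁ refl
    S⊆taken (there (here refl)) = inj₂ (x~q , inj₁ q-undominated)
    S⊆taken (there (there v∈)) = inj₂ (proj₂ (∈-filter⁻ leaf? {xs = B} v∈))

    rest⊆B : rest ⊆ B
    rest⊆B = filter-⊆ untaken? B

    rest-untaken : ∀ {v} → v ∈ rest → ¬ Taken v
    rest-untaken v∈ = proj₂ (∈-filter⁻ untaken? {xs = B} v∈)

    B⊆S∪rest : ∀ {v} → v ∈ B → v ∈ members S ⊎ v ∈ rest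
    B⊆S∪rest {v} v∈B with untaken? v
    ... | yes untaken = inj₂ (∈-filter⁺ untaken? v∈B untaken)
    ... | no taken with decidable-stable ((v ≟ x) ⊎-dec leaf? v) taken
    ...   | inj₁ refl = inj₁ (here refl)
    ...   | inj₂ v-leaf = inj₁ (there (there (∈-filter⁺ leaf? v∈B v-leaf)))

    x∉D : ¬ (x ∈ D)
    x∉D x∈D = q-undominated (lose x∈D (inj₂ x~q))

    dominated-other⇒rest : ∀ {w} → w ∈ B → w ≢ x → Dominated D w → HasOtherNeighbour w → w ∈ rest
    dominated-other⇒rest w∈B w≢x dom other = ∈-filter⁺ untaken? w∈B untaken
      where
      untaken : ¬ Taken _
      untaken (inj₁ w≡x) = w≢x w≡x
      untaken (inj₂ (_ , inj₁ undom)) = undom dom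
      untaken (inj₂ (_ , inj₂ no-other)) = no-other other

    D≢x : ∀ {d} → d ∈ D → d ≢ x
    D≢x d∈D refl = x∉D d∈D

    D-neighbour⇒rest : ∀ {d w} → d ∈ D → w ∈ B → d ~ w → w ≢ x → w ∈ rest
    D-neighbour⇒rest {d} {w} d∈D w∈B d~w w≢x =
      dominated-other⇒rest w∈B w≢x (lose d∈D (inj₂ d~w)) (lose (D⊆B d∈D) (~-sym d w d~w , D≢x d∈D))

    rest-dominated : Dominates D rest
    rest-dominated {v} v∈ with B⊆N[D]∪N[x] (rest⊆B v∈)
    ... | inj₁ dom = dom
    ... | inj₂ (inj₁ refl) = ⊥-elim (rest-untaken v∈ (inj₁ refl))
    ... | inj₂ (inj₂ x~v) = decidable-stable (dominated? D v) (λ undom → rest-untaken v∈ (inj₂ (x~v , inj₁ undom)))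

    dominator⇒rest : ∀ {v d} → v ∈ rest → d ∈ D → N[ d ]∋ v → d ∈ rest
    dominator⇒rest v∈ d∈D (inj₁ refl) = v∈
    dominator⇒rest {v} v∈ d∈D (inj₂ d~v) =
      dominated-other⇒rest (D⊆B d∈D) (D≢x d∈D) (lose d∈D (inj₁ refl)) (lose (rest⊆B v∈) (d~v , v≢x))
      where
      v≢x : v ≢ x
      v≢x v≡x = rest-untaken v∈ (inj₁ v≡x)

    D′⊆rest : D′ ⊆ rest
    D′⊆rest d∈ = proj₂ (∈-filter⁻ (_∈? rest) {xs = D} d∈)

    |D′|≤|D| : length D′ ≤ length D
    |D′|≤|D| = length-filter (_∈? rest) D

    D′-dominates-rest : Dominates D′ rest
    D′-dominates-rest v∈ with find (rest-dominated v∈)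
    ... | d , d∈D , closed = lose (∈-filter⁺ (_∈? rest) d∈D (dominator⇒rest v∈ d∈D closed)) closed

    rest-otherNeighbour : ∀ {v} → v ∈ rest → ∃[ w ] (w ∈ B × v ~ w × w ≢ x)
    rest-otherNeighbour {v} v∈ with x ~? v
    ... | yes x~v = find (decidable-stable (hasOtherNeighbour? v)
                            (λ no-other → rest-untaken v∈ (inj₂ (x~v , inj₂ no-other))))
    ... | no ¬x~v with noIsolated (rest⊆B v∈)
    ...   | w , w∈B , v~w = w , w∈B , v~w , λ { refl → ¬x~v (~-sym v x v~w) }

    rest-noIsolated : NoIsolated rest
    rest-noIsolated {v} v∈ with find (rest-dominated v∈)
    ... | d , d∈D , inj₂ d~v = d , dominator⇒rest v∈ d∈D (inj₂ d~v) , ~-sym d v d~v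
    ... | d , d∈D , inj₁ refl with rest-otherNeighbour v∈
    ...   | w , w∈B , v~w , w≢x = w , D-neighbour⇒rest d∈D w∈B v~w w≢x , v~w

    extend : ∀ {k} → StarPartition rest k → k ≤ length D → StarPartition B (suc (length D))
    extend {k} P k≤ = record
      { stars    = S ∷ stars
      ; size≤    = s≤s (≤-trans size≤ k≤)
      ; within   = S⊆B ∷ All.map (λ T⊆rest {v} v∈T → rest⊆B (T⊆rest v∈T)) within
      ; covering = covering′
      ; disjoint = All.map (λ T⊆rest {v} v∈S v∈T → rest-untaken (T⊆rest v∈T) (S⊆taken v∈S)) within ∷ disjoint
      }
      where
      open StarPartition P
      covering′ : ∀ {v} → v ∈ B → Any (λ T → v ∈ members T) (S ∷ stars)
      covering′ v∈B with B⊆S∪rest v∈B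
      ... | inj₁ v∈S = here v∈S
      ... | inj₂ v∈rest = there (covering v∈rest)

  dominating⇒starPartition : ∀ n {D B} → length D ≤ n → NoIsolated B → D ⊆ B → Dominates D B →
                             StarPartition B (length D)
  dominating⇒starPartition _ {[]} _ _ _ dom = record
    { stars = [] ; size≤ = z≤n ; within = [] ; covering = λ v∈B → ⊥-elim (undominated (dom v∈B)) ; disjoint = [] }
    where
    undominated : ∀ {v} → ¬ Dominated [] v
    undominated ()
  dominating⇒starPartition (suc n) {c ∷ D} {B} (s≤s |D|≤n) noIsolated c∷D⊆B dom =
    byPrivateNeighbour (any? (λ q → (c ~? q) ×-dec ¬? (dominated? D q)) B)
    where
    HasPrivateNeighbour : Set
    HasPrivateNeighbour = Any (λ q → c ~ q × ¬ Dominated D q) B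

    c∈B : c ∈ B
    c∈B = c∷D⊆B (here refl)

    neighbour-dominated : ¬ HasPrivateNeighbour → ∀ {v} → v ∈ B → c ~ v → Dominated D v
    neighbour-dominated no-private {v} v∈B c~v =
      decidable-stable (dominated? D v) (λ undominated → no-private (lose v∈B (c~v , undominated)))

    D-dominates : ¬ HasPrivateNeighbour → Dominated D c → Dominates D B
    D-dominates no-private c-dominated v∈B with dom v∈B
    ... | here (inj₁ refl) = c-dominated
    ... | here (inj₂ c~v) = neighbour-dominated no-private v∈B c~v
    ... | there dominated = dominated

    D-or-N[_] : ∀ d → ¬ HasPrivateNeighbour → c ~ d → ∀ {v} → v ∈ B → Dominated D v ⊎ N[ d ]∋ v
    D-or-N[ d ] no-private c~d v∈B with dom v∈B
    ... | here (inj₁ refl) = inj₂ (inj₂ (~-sym c d c~d))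
    ... | here (inj₂ c~v) = inj₁ (neighbour-dominated no-private v∈B c~v)
    ... | there dominated = inj₁ dominated

    peel : ∀ x q → x ∈ B → q ∈ B → x ~ q → ¬ Dominated D q →
           (∀ {v} → v ∈ B → Dominated D v ⊎ N[ x ]∋ v) → StarPartition B (suc (length D))
    peel x q x∈B q∈B x~q q-undominated D-or-N[x] = P.extend
        (dominating⇒starPartition n (≤-trans P.|D′|≤|D| |D|≤n) P.rest-noIsolated P.D′⊆rest P.D′-dominates-rest)
        P.|D′|≤|D|
      where
      module P = Peel D B x q x∈B q∈B x~q q-undominated D-or-N[x] (c∷D⊆B ∘ there) noIsolated

    -- A private neighbour q of c becomes a leaf of the star at c.  Without one, c is redundant
    -- unless c is itself undominated by D, and then c becomes a leaf of a star at one of its neighbours.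
    byPrivateNeighbour : Dec HasPrivateNeighbour → StarPartition B (suc (length D))
    byPrivateNeighbour (yes ∃private) with find ∃private
    ... | q , q∈B , c~q , q-private = peel c q c∈B q∈B c~q q-private (swap ∘ Any.toSum ∘ dom)
    byPrivateNeighbour (no no-private) with dominated? D c
    ... | yes c-dominated = weaken (n≤1+n _)
          (dominating⇒starPartition n |D|≤n noIsolated (c∷D⊆B ∘ there) (D-dominates no-private c-dominated))
    ... | no c-undominated with noIsolated c∈B
    ...   | d , d∈B , c~d = peel d c d∈B c∈B (~-sym c d c~d) c-undominated (D-or-N[ d ] no-private c~d)

_≟ᵒ_ : DecidableEquality Ori
up ≟ᵒ up = yes refl
up ≟ᵒ down = no (λ ())
down ≟ᵒ up = no (λ ())
down ≟ᵒ down = yes refl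

_≟ᶜ_ : DecidableEquality Cell
cell x y o ≟ᶜ cell x′ y′ o′ with x ℤ.≟ x′ | y ℤ.≟ y′ | o ≟ᵒ o′
... | yes refl | yes refl | yes refl = yes refl
... | no x≢x′ | _ | _ = no λ { refl → x≢x′ refl }
... | yes _ | no y≢y′ | _ = no λ { refl → y≢y′ refl }
... | yes _ | yes _ | no o≢o′ = no λ { refl → o≢o′ refl }

adj? : ∀ c d → Dec (Adj c d)
adj? (cell x y up) (cell x′ y′ down) =
  ((x′ ℤ.≟ x) ×-dec (y′ ℤ.≟ y)) ⊎-dec ((x′ ℤ.≟ x ℤ.- 1ℤ) ×-dec (y′ ℤ.≟ y)) ⊎-dec ((x′ ℤ.≟ x) ×-dec (y′ ℤ.≟ y ℤ.- 1ℤ))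
adj? (cell x y down) (cell x′ y′ up) =
  ((x′ ℤ.≟ x) ×-dec (y′ ℤ.≟ y)) ⊎-dec ((x′ ℤ.≟ x ℤ.+ 1ℤ) ×-dec (y′ ℤ.≟ y)) ⊎-dec ((x′ ℤ.≟ x) ×-dec (y′ ℤ.≟ y ℤ.+ 1ℤ))
adj? (cell _ _ up) (cell _ _ up) = no (λ ())
adj? (cell _ _ down) (cell _ _ down) = no (λ ())

adj-sym : ∀ c d → Adj c d → Adj d c
adj-sym (cell x y up) (cell _ _ down) (inj₁ (refl , refl)) = inj₁ (refl , refl)
adj-sym (cell x y up) (cell _ _ down) (inj₂ (inj₁ (refl , refl))) = inj₂ (inj₁ (sym (//-rightDividesˡ 1ℤ x) , refl))
adj-sym (cell x y up) (cell _ _ down) (inj₂ (inj₂ (refl , refl))) = inj₂ (inj₂ (refl , sym (//-rightDividesˡ 1ℤ y)))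
adj-sym (cell x y down) (cell _ _ up) (inj₁ (refl , refl)) = inj₁ (refl , refl)
adj-sym (cell x y down) (cell _ _ up) (inj₂ (inj₁ (refl , refl))) = inj₂ (inj₁ (sym (//-rightDividesʳ 1ℤ x) , refl))
adj-sym (cell x y down) (cell _ _ up) (inj₂ (inj₂ (refl , refl))) = inj₂ (inj₂ (refl , sym (//-rightDividesʳ 1ℤ y)))

adj-common⇒¬adj : ∀ c d e → Adj c d → Adj c e → ¬ Adj d e
adj-common⇒¬adj (cell _ _ up) (cell _ _ down) (cell _ _ down) _ _ ()
adj-common⇒¬adj (cell _ _ down) (cell _ _ up) (cell _ _ up) _ _ ()

open StarPartitions _≟ᶜ_ Adj adj? adj-sym
open import Data.List.Membership.DecPropositional _≟ᶜ_ using () renaming (_∈?_ to _∈ᶜ?_)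

HasDominatingSubset : CellSet → ℕ → Set
HasDominatingSubset B k = ∃[ D ] (length D ≡ k × D ⊆ B × All (Dominated D) B)

hasDominatingSubset? : ∀ B k → Dec (HasDominatingSubset B k)
hasDominatingSubset? B = ∃-listOver? B (λ D → All.all? (dominated? D) B)

self-dominating : ∀ B → HasDominatingSubset B (length B)
self-dominating B = B , refl , (λ v∈B → v∈B) , All.tabulate (λ v∈B → lose v∈B (inj₁ refl))

recentre : ∀ {B} → IsRegular B → ∀ c {e} → e ∈ B → InMaxFragment c e →
           ∃[ c′ ] (c′ ∈ B × (∀ {v} → v ∈ B → InMaxFragment c v → InMaxFragment c′ v))
recentre regular c c∈B (inj₁ refl) = c , c∈B , λ _ c∋v → c∋v
recentre {B} regular c {e} e∈B (inj₂ c~e) with c ∈ᶜ? B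
... | yes c∈B = c , c∈B , λ _ c∋v → c∋v
... | no c∉B = e , e∈B , e∋
  where
  e∋ : ∀ {v} → v ∈ B → InMaxFragment c v → InMaxFragment e v
  e∋ v∈B (inj₁ refl) = ⊥-elim (c∉B v∈B)
  e∋ {v} v∈B (inj₂ c~v) with v ≟ᶜ e
  ... | yes v≡e = inj₁ v≡e
  ... | no v≢e = ⊥-elim (c∉B
        (regular v∈B e∈B v≢e (adj-common⇒¬adj c v e c~v c~e) (adj-sym c v c~v) (adj-sym c e c~e)))

centres⇒dominatingSubset : ∀ {B} → IsRegular B → (cs : List Cell) →
  ∃[ D ] (length D ≤ length cs × D ⊆ B × (∀ {v} → v ∈ B → Dominated cs v → Dominated D v))
centres⇒dominatingSubset regular [] = [] , z≤n , (λ ()) , λ _ ()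
centres⇒dominatingSubset {B} regular (c ∷ cs) with centres⇒dominatingSubset regular cs | any? (N[ c ]∋?_) B
... | D , |D|≤|cs| , D⊆B , D-dom | no misses-B =
  D , m≤n⇒m≤1+n |D|≤|cs| , D⊆B ,
  λ { v∈B (here c∋v) → ⊥-elim (misses-B (lose v∈B c∋v)) ; v∈B (there cs∋v) → D-dom v∈B cs∋v }
... | D , |D|≤|cs| , D⊆B , D-dom | yes meets-B with find meets-B
...   | e , e∈B , c∋e with recentre regular c e∈B c∋e
...     | c′ , c′∈B , c′∋ =
  c′ ∷ D , s≤s |D|≤|cs| , ∈-∷⁺ʳ c′∈B D⊆B ,
  λ { v∈B (here c∋v) → here (c′∋ v∈B c∋v) ; v∈B (there cs∋v) → there (D-dom v∈B cs∋v) }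

cover⇒dominatingSubset : ∀ {B m} → IsRegular B → HasCover B m → ∃[ k ] (k ≤ m × HasDominatingSubset B k)
cover⇒dominatingSubset {B} regular (cs , refl , covers) with centres⇒dominatingSubset regular cs
... | D , |D|≤|cs| , D⊆B , D-dom = length D , |D|≤|cs| , D , refl , D⊆B , All.tabulate (λ v∈B → D-dom v∈B (covered v∈B))
  where
  covered : ∀ {v} → v ∈ B → Dominated cs v
  covered v∈B with covers v∈B
  ... | c , c∈cs , c∋v = lose c∈cs c∋v

dominatingSubset⇒cover : ∀ {B k} → HasDominatingSubset B k → HasCover B k
dominatingSubset⇒cover (D , |D|≡k , _ , D-dom) = D , |D|≡k , λ v∈B → find (All.lookup D-dom v∈B)

fragment⊆maxFragment : ∀ F {v} → InFragment F v → InMaxFragment (centre F) v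
fragment⊆maxFragment F (here refl) = inj₁ refl
fragment⊆maxFragment F (there v∈) = inj₂ (nbAdj F v∈)

partition⇒cover : ∀ {B m} → HasPartition B m → HasCover B m
partition⇒cover {B} (Fs , |Fs|≡m , _ , covers , _) = map centre Fs , trans (length-map centre Fs) |Fs|≡m , centres-cover
  where
  centres-cover : CoversB B (map centre Fs)
  centres-cover v∈B with covers v∈B
  ... | i , i∋v = centre (lookup Fs i) , ∈-map⁺ centre (∈-lookup i) , fragment⊆maxFragment (lookup Fs i) i∋v

DisjointFragments : Fragment → Fragment → Set
DisjointFragments F G = ∀ {v} → InFragment F v → InFragment G v → ⊥

fragments⇒partition : ∀ {B} Fs → All (λ F → ∀ {v} → InFragment F v → v ∈ B) Fs →
                      (∀ {v} → v ∈ B → Any (λ F → InFragment F v) Fs) → AllPairs DisjointFragments Fs →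
                      IsPartition B Fs
fragments⇒partition Fs within covers disjoint =
  (λ i → All.lookup within (∈-lookup i)) ,
  (λ v∈B → Any.index (covers v∈B) , Anyₚ.lookup-index (covers v∈B)) ,
  index-unique Fs disjoint
  where
  index-unique : ∀ Fs → AllPairs DisjointFragments Fs → ∀ (i j : Fin (length Fs)) {v} →
                 InFragment (lookup Fs i) v → InFragment (lookup Fs j) v → i ≡ j
  index-unique (F ∷ Fs) (_ ∷ _) zero zero _ _ = refl
  index-unique (F ∷ Fs) (F#Fs ∷ _) zero (suc j) i∋v j∋v = ⊥-elim (All.lookup F#Fs (∈-lookup j) i∋v j∋v)
  index-unique (F ∷ Fs) (F#Fs ∷ _) (suc i) zero i∋v j∋v = ⊥-elim (All.lookup F#Fs (∈-lookup i) j∋v i∋v)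
  index-unique (F ∷ Fs) (_ ∷ Fs#) (suc i) (suc j) i∋v j∋v = cong suc (index-unique Fs Fs# i j i∋v j∋v)

toFragment : Star → Fragment
toFragment S = frag (hub S) (leaf S) (leaves S) (hub~leaves S)

starPartition⇒partition : ∀ {B k} → StarPartition B k → ∃[ m ] (m ≤ k × HasPartition B m)
starPartition⇒partition P =
  length stars , size≤ , map toFragment stars , length-map toFragment stars ,
  fragments⇒partition (map toFragment stars) (Allₚ.map⁺ within) (Anyₚ.map⁺ ∘ covering) (AllPairsₚ.map⁺ disjoint)
  where open StarPartition P

dominatingSubset⇒partition : ∀ {B k} → IsBoard B → HasDominatingSubset B k → ∃[ m ] (m ≤ k × HasPartition B m)
dominatingSubset⇒partition board (D , refl , D⊆B , D-dom) =
  starPartition⇒partition (dominating⇒starPartition (length D) ≤-refl board D⊆B (All.lookup D-dom))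

mainTheorem11 : (B : CellSet) → IsBoard B → IsRegular B →
    ∃[ n ] (IsMinimum (HasCover B) n × IsMinimum (HasPartition B) n)
mainTheorem11 B board regular with least (hasDominatingSubset? B) (self-dominating B)
... | n , dominatingₙ , n-least =
  n , (dominatingSubset⇒cover dominatingₙ , cover-bound) , (partitionₙ , λ m → cover-bound m ∘ partition⇒cover)
  where
  cover-bound : ∀ m → HasCover B m → n ≤ m
  cover-bound m cover with cover⇒dominatingSubset regular cover
  ... | k , k≤m , dominatingₖ = ≤-trans (n-least k dominatingₖ) k≤m

  partitionₙ : HasPartition B n
  partitionₙ with dominatingSubset⇒partition board dominatingₙ
  ... | m , m≤n , partitionₘ = subst (HasPartition B) (≤-antisym m≤n (cover-bound m (partition⇒cover partitionₘ))) partitionₘ
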